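{- Let $(X,R)$ be the 3-cyclic forcing network and let $K_{m,n}$ be the complete bipartite graph with bipartition $V(K_{m,n})=A\cup B$ ($|A|=m\ge1$, $|B|=n\ge1$, every edge joins $A$ to $B$). Suppose $K_{m,n}$ is $X$-colored so that each of the colors $1,2,3$ appears at least once in the initial coloring. If every vertex of $A$ is colored $3$, or every vertex of $B$ is colored $3$, then with forcing with propagation the end state has all vertices colored $1$. Otherwise the end state has all vertices colored $3$.
   Context: The 3-cyclic forcing network is $X=\{1,2,3\}$ with the ordered list of rules $R=(1\to 2,\,2\to 3,\,3\to 1)$. Applying a rule $a\to b$ in a forcing step means simultaneously recoloring with $a$ every vertex of color $b$ having a neighbor of color $a$; a propagating forcing step with rule $a\to b$ repeats forcing steps with that rule until no vertex of color $b$ has a neighbor of color $a$. The process with propagation applies propagating forcing steps with the rules in cyclic order $1\to2,2\to3,3\to1,1\to2,\dots$ until no rule can be applied; the final coloring is the end state. -}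

module Defs where

open import Data.Nat using (ℕ)
open import Data.Fin using (Fin)
open import Data.Sum using (_⊎_; inj₁; inj₂)
open import Data.Product using (Σ; ∃; _×_; _,_)
open import Data.Empty using (⊥)
open import Data.Unit using (⊤)
open import Relation.Nullary using (¬_)
open import Relation.Binary.PropositionalEquality using (_≡_)

data Color : Set where
  c1 c2 c3 : Color

record Rule : Set where
  constructor _⇒_
  field
    src : Color
    tgt : Color

data RuleIx : Set where
  r12 r23 r31 : RuleIx

rule : RuleIx → Rule
rule r12 = c1 ⇒ c2
rule r23 = c2 ⇒ c3
rule r31 = c3 ⇒ c1

next : RuleIx → RuleIx
next r12 = r23
next r23 = r31
next r31 = r12

module Forcing {V : Set} (Adj : V → V → Set) where

  Coloring : Set
  Coloring = V → Color

  Forced : Rule → Coloring → V → Set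
  Forced (a ⇒ b) c v = c v ≡ b × ∃ λ w → Adj v w × c w ≡ a

  Applicable : Rule → Coloring → Set
  Applicable r c = ∃ λ v → Forced r c v

  ForceStep : Rule → Coloring → Coloring → Set
  ForceStep (a ⇒ b) c c' =
    ∀ v → (Forced (a ⇒ b) c v → c' v ≡ a) × (¬ Forced (a ⇒ b) c v → c' v ≡ c v)

  data PropStep (r : Rule) : Coloring → Coloring → Set where
    done : ∀ {c c'} → ¬ Applicable r c → (∀ v → c' v ≡ c v) → PropStep r c c'
    step : ∀ {c c' c''} → Applicable r c → ForceStep r c c' → PropStep r c' c'' →
           PropStep r c c''

  NoRuleApplicable : Coloring → Set
  NoRuleApplicable c = ∀ i → ¬ Applicable (rule i) c

  data Process : RuleIx → Coloring → Coloring → Set where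
    stop : ∀ {i c e} → NoRuleApplicable c → (∀ v → e v ≡ c v) → Process i c e
    go   : ∀ {i c c' e} → ¬ NoRuleApplicable c → PropStep (rule i) c c' →
           Process (next i) c' e → Process i c e

  EndState : Coloring → Coloring → Set
  EndState c e = Process r12 c e

-- complete bipartite graph K_{m,n} with parts A = Fin m, B = Fin n
KAdj : (m n : ℕ) → (Fin m ⊎ Fin n) → (Fin m ⊎ Fin n) → Set
KAdj m n (inj₁ _) (inj₁ _) = ⊥
KAdj m n (inj₁ _) (inj₂ _) = ⊤
KAdj m n (inj₂ _) (inj₁ _) = ⊤
KAdj m n (inj₂ _) (inj₂ _) = ⊥

-- On K_{m,n} whether a vertex is forced depends only on its side and its current colour,
-- so every colouring the process reaches has the form v ↦ s (side v) (c v) for a map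
-- s : Side → Color → Color. Whether a rule applies, and how s changes, depends only on
-- the two palettes of c (the sets of colours present on A and on B). The theorem thus
-- reduces to running the process on recolouring maps for each of the 64 pairs of palettes.
module Submission where

open import Data.Bool using (Bool; true; false; T; not; _∧_; _∨_; if_then_else_)
open import Data.Bool.Properties using (T-∧; T-∨)
open import Data.Empty using (⊥-elim)
open import Data.Fin using (Fin; zero)
open import Data.Fin.Properties using (any?)
open import Data.Maybe using (Maybe; just; nothing; maybe; _>>=_)
open import Data.Nat using (ℕ; zero; suc; _≥_)
open import Data.Product using (∃; _×_; _,_; proj₁; proj₂; map₂)
open import Data.Product.Function.NonDependent.Propositional using (_×-⇔_)
open import Data.Sum.Function.Propositional using (_⊎-⇔_)
open import Data.Sum using (_⊎_; inj₁; inj₂; [_,_])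
import Data.Sum as Sum
open import Data.Unit using (tt)
open import Function using (_∘_; id)
open import Function.Bundles using (_⇔_; mk⇔; Equivalence)
open import Function.Properties.Equivalence using () renaming (trans to ⇔-trans)
open import Relation.Binary.Definitions using (DecidableEquality)
open import Relation.Binary.PropositionalEquality using (_≡_; refl; sym; trans; subst)
open import Relation.Nullary using (¬_; yes; no)
open import Relation.Nullary.Decidable using (⌊_⌋; toWitness; fromWitness)

open import Defs

open Equivalence using (to; from)

_≟ᶜ_ : DecidableEquality Color
c1 ≟ᶜ c1 = yes refl
c2 ≟ᶜ c2 = yes refl
c3 ≟ᶜ c3 = yes refl
c1 ≟ᶜ c2 = no λ ()
c1 ≟ᶜ c3 = no λ ()
c2 ≟ᶜ c1 = no λ ()
c2 ≟ᶜ c3 = no λ ()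
c3 ≟ᶜ c1 = no λ ()
c3 ≟ᶜ c2 = no λ ()

_==_ : Color → Color → Bool
x == y = ⌊ x ≟ᶜ y ⌋

T-== : ∀ {x y} → T (x == y) ⇔ x ≡ y
T-== {x} {y} = mk⇔ (toWitness {a? = x ≟ᶜ y}) fromWitness

T-not-∨ : ∀ b {q} → T (not b ∨ q) ⇔ (T b → T q)
T-not-∨ true  = mk⇔ (λ t _ → t) (λ f → f tt)
T-not-∨ false = mk⇔ (λ _ ()) (λ _ → tt)

if-T : ∀ {A : Set} {b} {x y : A} → T b → (if b then x else y) ≡ x
if-T {b = true} _ = refl

if-¬T : ∀ {A : Set} {b} {x y : A} → ¬ T b → (if b then x else y) ≡ y
if-¬T {b = true}  ¬t = ⊥-elim (¬t tt)
if-¬T {b = false} _  = refl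

if-reflects : ∀ {P A : Set} {b} {x y : A} → T b ⇔ P →
  (P → (if b then x else y) ≡ x) × (¬ P → (if b then x else y) ≡ y)
if-reflects {b = true}  b⇔P = (λ _ → refl) , λ ¬p → ⊥-elim (¬p (to b⇔P tt))
if-reflects {b = false} b⇔P = (λ p → ⊥-elim (from b⇔P p)) , λ _ → refl

T-∨³ : ∀ {x y z} → T (x ∨ y ∨ z) ⇔ (T x ⊎ T y ⊎ T z)
T-∨³ {x} {y} {z} =
  ⇔-trans (T-∨ {x}) (mk⇔ (Sum.map₂ (to (T-∨ {y}))) (Sum.map₂ (from (T-∨ {y}))))

someColour : (Color → Bool) → Bool
someColour P = P c1 ∨ P c2 ∨ P c3

everyColour : (Color → Bool) → Bool
everyColour P = P c1 ∧ P c2 ∧ P c3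

T-someColour : ∀ P → T (someColour P) ⇔ ∃ λ x → T (P x)
T-someColour P = mk⇔ eliminate (from (T-∨³ {P c1}) ∘ introduce)
  where
  eliminate : T (someColour P) → ∃ λ x → T (P x)
  eliminate = [ (c1 ,_) , [ (c2 ,_) , (c3 ,_) ] ] ∘ to (T-∨³ {P c1})
  introduce : (∃ λ x → T (P x)) → T (P c1) ⊎ T (P c2) ⊎ T (P c3)
  introduce (c1 , t) = inj₁ t
  introduce (c2 , t) = inj₂ (inj₁ t)
  introduce (c3 , t) = inj₂ (inj₂ t)

T-everyColour : ∀ P → T (everyColour P) ⇔ (∀ x → T (P x))
T-everyColour P = mk⇔ eliminate introduce
  where
  split : T (everyColour P) → T (P c1) × T (P c2) × T (P c3)
  split = map₂ (to (T-∧ {P c2})) ∘ to (T-∧ {P c1})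
  eliminate : T (everyColour P) → ∀ x → T (P x)
  eliminate t c1 = proj₁ (split t)
  eliminate t c2 = proj₁ (proj₂ (split t))
  eliminate t c3 = proj₂ (proj₂ (split t))
  introduce : (∀ x → T (P x)) → T (everyColour P)
  introduce h = from (T-∧ {P c1}) (h c1 , from (T-∧ {P c2}) (h c2 , h c3))

>>=-just : ∀ {A B : Set} (ma : Maybe A) {f : A → Maybe B} {b} →
  (ma >>= f) ≡ just b → ∃ λ a → ma ≡ just a × f a ≡ just b
>>=-just (just a) eq = a , refl , eq

if-just : ∀ {A : Set} b {x : Maybe A} {a e} →
  (if b then x else just a) ≡ just e → (b ≡ true × x ≡ just e) ⊎ (b ≡ false × a ≡ e)
if-just true  eq   = inj₁ (refl , eq)
if-just false refl = inj₂ (refl , refl)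

T-maybe : ∀ {A : Set} {P : A → Bool} ma → T (maybe P false ma) → ∃ λ a → ma ≡ just a × T (P a)
T-maybe (just a) t = a , refl , t

record Palette : Set where
  constructor palette
  field has₁ has₂ has₃ : Bool

_∋_ : Palette → Color → Bool
p ∋ c1 = Palette.has₁ p
p ∋ c2 = Palette.has₂ p
p ∋ c3 = Palette.has₃ p

tabulate : (Color → Bool) → Palette
tabulate P = palette (P c1) (P c2) (P c3)

tabulate-∋ : ∀ P x → tabulate P ∋ x ≡ P x
tabulate-∋ P c1 = refl
tabulate-∋ P c2 = refl
tabulate-∋ P c3 = refl

everyBool : (Bool → Bool) → Bool
everyBool P = P true ∧ P false

everyPalette : (Palette → Bool) → Bool
everyPalette P = everyBool λ a → everyBool λ b → everyBool λ c → P (palette a b c)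

everyBool-sound : ∀ P → T (everyBool P) → ∀ b → T (P b)
everyBool-sound P t true  = proj₁ (to (T-∧ {P true}) t)
everyBool-sound P t false = proj₂ (to (T-∧ {P true}) t)

everyPalette-sound : ∀ P → T (everyPalette P) → ∀ p → T (P p)
everyPalette-sound P t (palette a b c) =
  everyBool-sound (λ c → P (palette a b c))
    (everyBool-sound (λ b → everyBool λ c → P (palette a b c))
      (everyBool-sound (λ a → everyBool λ b → everyBool λ c → P (palette a b c)) t a) b) c

nonEmpty : Palette → Bool
nonEmpty p = someColour (p ∋_)

only : Palette → Color → Bool
only p t = everyColour λ y → not (p ∋ y) ∨ y == t

T-only : ∀ p t → T (only p t) ⇔ (∀ y → T (p ∋ y) → y ≡ t)
T-only p t = ⇔-trans (T-everyColour λ y → not (p ∋ y) ∨ y == t)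
                     (mk⇔ (λ h y → to T-== ∘ to (T-not-∨ (p ∋ y)) (h y))
                          (λ h y → from (T-not-∨ (p ∋ y)) (from T-== ∘ h y)))

image : Palette → (Color → Color) → Palette
image p g = tabulate λ x → someColour λ y → p ∋ y ∧ g y == x

paletteOf : ∀ {k} → (Fin k → Color) → Palette
paletteOf f = tabulate λ x → ⌊ any? (λ i → f i ≟ᶜ x) ⌋

module _ {k} (f : Fin k → Color) where

  T-paletteOf-∋ : ∀ x → T (paletteOf f ∋ x) ⇔ ∃ λ i → f i ≡ x
  T-paletteOf-∋ x rewrite tabulate-∋ (λ x → ⌊ any? (λ i → f i ≟ᶜ x) ⌋) x =
    mk⇔ toWitness fromWitness

  T-someColour-paletteOf : (P : Color → Bool) →
    T (someColour λ y → paletteOf f ∋ y ∧ P y) ⇔ ∃ λ i → T (P (f i))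
  T-someColour-paletteOf P =
    ⇔-trans (T-someColour λ y → paletteOf f ∋ y ∧ P y) (mk⇔ eliminate introduce)
    where
    eliminate : (∃ λ y → T (paletteOf f ∋ y ∧ P y)) → ∃ λ i → T (P (f i))
    eliminate (y , t) with to (T-∧ {paletteOf f ∋ y}) t
    ... | present , holds with to (T-paletteOf-∋ y) present
    ...   | i , refl = i , holds
    introduce : (∃ λ i → T (P (f i))) → ∃ λ y → T (paletteOf f ∋ y ∧ P y)
    introduce (i , holds) = f i , from T-∧ (from (T-paletteOf-∋ (f i)) (i , refl) , holds)

  T-image-paletteOf-∋ : ∀ g x → T (image (paletteOf f) g ∋ x) ⇔ ∃ λ i → g (f i) ≡ x
  T-image-paletteOf-∋ g x rewrite tabulate-∋ (λ x → someColour λ y → paletteOf f ∋ y ∧ g y == x) x =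
    ⇔-trans (T-someColour-paletteOf (λ y → g y == x))
            (mk⇔ (λ (i , t) → i , to T-== t) (λ (i , e) → i , from T-== e))

  T-only-paletteOf : ∀ t → T (only (paletteOf f) t) ⇔ (∀ i → f i ≡ t)
  T-only-paletteOf t = ⇔-trans (T-only _ t) (mk⇔ eliminate introduce)
    where
    eliminate : (∀ y → T (paletteOf f ∋ y) → y ≡ t) → ∀ i → f i ≡ t
    eliminate h i = h (f i) (from (T-paletteOf-∋ (f i)) (i , refl))
    introduce : (∀ i → f i ≡ t) → ∀ y → T (paletteOf f ∋ y) → y ≡ t
    introduce h y present = let i , fi≡y = to (T-paletteOf-∋ y) present in trans (sym fi≡y) (h i)

  only-image-paletteOf : ∀ g t → T (only (image (paletteOf f) g) t) → ∀ i → g (f i) ≡ t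
  only-image-paletteOf g t mono i =
    to (T-only _ t) mono (g (f i)) (from (T-image-paletteOf-∋ g (g (f i))) (i , refl))

  nonEmpty-paletteOf : Fin k → T (nonEmpty (paletteOf f))
  nonEmpty-paletteOf i =
    from (T-someColour (paletteOf f ∋_)) (f i , from (T-paletteOf-∋ (f i)) (i , refl))

data Side : Set where
  A B : Side

opposite : Side → Side
opposite A = B
opposite B = A

Recolouring : Set
Recolouring = Side → Color → Color

module Machine (pa pb : Palette) where

  paletteOn : Side → Palette
  paletteOn A = pa
  paletteOn B = pb

  forced? : Rule → Recolouring → Side → Color → Bool
  forced? (a ⇒ b) s σ y = s σ y == b ∧ image (paletteOn (opposite σ)) (s (opposite σ)) ∋ a

  forcedOn? : Rule → Recolouring → Side → Bool
  forcedOn? r s σ = someColour λ y → paletteOn σ ∋ y ∧ forced? r s σ y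

  applicable? : Rule → Recolouring → Bool
  applicable? r s = forcedOn? r s A ∨ forcedOn? r s B

  force : Rule → Recolouring → Recolouring
  force r s σ y = if forced? r s σ y then Rule.src r else s σ y

  propagate : ℕ → Rule → Recolouring → Maybe Recolouring
  propagate zero    r s = if applicable? r s then nothing else just s
  propagate (suc k) r s = if applicable? r s then propagate k r (force r s) else just s

  anyApplicable? : Recolouring → Bool
  anyApplicable? s = applicable? (rule r12) s ∨ applicable? (rule r23) s ∨ applicable? (rule r31) s

  -- Fuel: a rule is exhausted after at most two forcing steps (a second one is needed when
  -- the first brings the source colour to a side for the first time), and four rounds end
  -- the process; were the fuel too small, endsIn? would be false and the table below fail.
  run : ℕ → RuleIx → Recolouring → Maybe Recolouring
  run zero    i s = if anyApplicable? s then nothing else just s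
  run (suc k) i s = if anyApplicable? s then propagate 2 (rule i) s >>= run k (next i) else just s

  monochrome? : Color → Recolouring → Bool
  monochrome? t s = only (image pa (s A)) t ∧ only (image pb (s B)) t

  endsIn? : Color → Bool
  endsIn? t = maybe (monochrome? t) false (run 4 r12 λ _ → id)

admissible : Palette → Palette → Bool
admissible pa pb = nonEmpty pa ∧ nonEmpty pb ∧ everyColour λ x → pa ∋ x ∨ pb ∋ x

expectedColour : Palette → Palette → Color
expectedColour pa pb = if only pa c3 ∨ only pb c3 then c1 else c3

endsIn-expectedColour : ∀ pa pb → T (admissible pa pb) →
  T (Machine.endsIn? pa pb (expectedColour pa pb))
endsIn-expectedColour pa pb = to (T-not-∨ (admissible pa pb)) (everyPalette-sound (verdict pa) table pb)
  where
  verdict : Palette → Palette → Bool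
  verdict pa pb = not (admissible pa pb) ∨ Machine.endsIn? pa pb (expectedColour pa pb)
  -- The proof tt is Agda evaluating the process for all 64 pairs of palettes.
  table : T (everyPalette (verdict pa))
  table = everyPalette-sound (everyPalette ∘ verdict) tt pa

module OnCompleteBipartite (m n : ℕ) (c : Fin m ⊎ Fin n → Color) where

  open Forcing (KAdj m n)

  pa pb : Palette
  pa = paletteOf (c ∘ inj₁)
  pb = paletteOf (c ∘ inj₂)

  open Machine pa pb

  side : Fin m ⊎ Fin n → Side
  side (inj₁ _) = A
  side (inj₂ _) = B

  -- realise (λ _ → id) is c up to η, so no extensionality is needed to start the process.
  realise : Recolouring → Coloring
  realise s v = s (side v) (c v)

  T-image-opposite-∋ : ∀ s v x →
    T (image (paletteOn (opposite (side v))) (s (opposite (side v))) ∋ x) ⇔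
    ∃ λ w → KAdj m n v w × realise s w ≡ x
  T-image-opposite-∋ s (inj₁ i) x =
    ⇔-trans (T-image-paletteOf-∋ (c ∘ inj₂) (s B) x) (mk⇔ (λ (j , e) → inj₂ j , tt , e) neighbour)
    where
    neighbour : (∃ λ w → KAdj m n (inj₁ i) w × realise s w ≡ x) → ∃ λ j → s B (c (inj₂ j)) ≡ x
    neighbour (inj₂ j , _ , e) = j , e
  T-image-opposite-∋ s (inj₂ j) x =
    ⇔-trans (T-image-paletteOf-∋ (c ∘ inj₁) (s A) x) (mk⇔ (λ (i , e) → inj₁ i , tt , e) neighbour)
    where
    neighbour : (∃ λ w → KAdj m n (inj₂ j) w × realise s w ≡ x) → ∃ λ i → s A (c (inj₁ i)) ≡ x
    neighbour (inj₁ i , _ , e) = i , e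

  T-forced? : ∀ r s v → T (forced? r s (side v) (c v)) ⇔ Forced r (realise s) v
  T-forced? (a ⇒ b) s v = ⇔-trans T-∧ (T-== ×-⇔ T-image-opposite-∋ s v a)

  T-applicable? : ∀ r s → T (applicable? r s) ⇔ Applicable r (realise s)
  T-applicable? r s = ⇔-trans (T-∨ {forcedOn? r s A}) (mk⇔ eliminate introduce)
    where
    onA : T (forcedOn? r s A) ⇔ ∃ λ i → Forced r (realise s) (inj₁ i)
    onA = ⇔-trans (T-someColour-paletteOf (c ∘ inj₁) (forced? r s A))
                  (mk⇔ (λ (i , t) → i , to (T-forced? r s (inj₁ i)) t)
                       (λ (i , f) → i , from (T-forced? r s (inj₁ i)) f))
    onB : T (forcedOn? r s B) ⇔ ∃ λ j → Forced r (realise s) (inj₂ j)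
    onB = ⇔-trans (T-someColour-paletteOf (c ∘ inj₂) (forced? r s B))
                  (mk⇔ (λ (j , t) → j , to (T-forced? r s (inj₂ j)) t)
                       (λ (j , f) → j , from (T-forced? r s (inj₂ j)) f))
    eliminate : T (forcedOn? r s A) ⊎ T (forcedOn? r s B) → Applicable r (realise s)
    eliminate (inj₁ t) = let i , f = to onA t in inj₁ i , f
    eliminate (inj₂ t) = let j , f = to onB t in inj₂ j , f
    introduce : Applicable r (realise s) → T (forcedOn? r s A) ⊎ T (forcedOn? r s B)
    introduce (inj₁ i , f) = inj₁ (from onA (i , f))
    introduce (inj₂ j , f) = inj₂ (from onB (j , f))

  applicable-sound : ∀ r s → applicable? r s ≡ true → Applicable r (realise s)
  applicable-sound r s eq = to (T-applicable? r s) (subst T (sym eq) tt)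

  inapplicable-sound : ∀ r s → applicable? r s ≡ false → ¬ Applicable r (realise s)
  inapplicable-sound r s eq = subst T eq ∘ from (T-applicable? r s)

  force-isForceStep : ∀ r s → ForceStep r (realise s) (realise (force r s))
  force-isForceStep (a ⇒ b) s v = if-reflects (T-forced? (a ⇒ b) s v)

  exhausted : ∀ r {s s'} → applicable? r s ≡ false × s ≡ s' → PropStep r (realise s) (realise s')
  exhausted r {s} (a? , refl) = done (inapplicable-sound r s a?) (λ _ → refl)

  propagate-sound : ∀ k r s {s'} → propagate k r s ≡ just s' → PropStep r (realise s) (realise s')
  propagate-sound zero    r s eq = [ (λ ()) ∘ proj₂ , exhausted r ] (if-just (applicable? r s) eq)
  propagate-sound (suc k) r s {s'} eq = [ forceOnce , exhausted r ] (if-just (applicable? r s) eq)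
    where
    forceOnce : applicable? r s ≡ true × propagate k r (force r s) ≡ just s' →
                PropStep r (realise s) (realise s')
    forceOnce (a? , rest) =
      step (applicable-sound r s a?) (force-isForceStep r s) (propagate-sound k r (force r s) rest)

  T-anyApplicable? : ∀ s → T (anyApplicable? s) ⇔ ∃ λ i → Applicable (rule i) (realise s)
  T-anyApplicable? s = ⇔-trans (T-∨³ {applicable? (rule r12) s}) (mk⇔ eliminate introduce)
    where
    ApplicableOne : Set
    ApplicableOne =
      T (applicable? (rule r12) s) ⊎ T (applicable? (rule r23) s) ⊎ T (applicable? (rule r31) s)
    eliminate : ApplicableOne → ∃ λ i → Applicable (rule i) (realise s)
    eliminate (inj₁ t)        = r12 , to (T-applicable? (rule r12) s) t
    eliminate (inj₂ (inj₁ t)) = r23 , to (T-applicable? (rule r23) s) t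
    eliminate (inj₂ (inj₂ t)) = r31 , to (T-applicable? (rule r31) s) t
    introduce : (∃ λ i → Applicable (rule i) (realise s)) → ApplicableOne
    introduce (r12 , ap) = inj₁ (from (T-applicable? (rule r12) s) ap)
    introduce (r23 , ap) = inj₂ (inj₁ (from (T-applicable? (rule r23) s) ap))
    introduce (r31 , ap) = inj₂ (inj₂ (from (T-applicable? (rule r31) s) ap))

  stuck-sound : ∀ s → anyApplicable? s ≡ false → NoRuleApplicable (realise s)
  stuck-sound s eq i ap = subst T eq (from (T-anyApplicable? s) (i , ap))

  unstuck-sound : ∀ s → anyApplicable? s ≡ true → ¬ NoRuleApplicable (realise s)
  unstuck-sound s eq none =
    let i , ap = to (T-anyApplicable? s) (subst T (sym eq) tt) in none i ap

  halted : ∀ {i s e} → anyApplicable? s ≡ false × s ≡ e → Process i (realise s) (realise e)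
  halted {s = s} (any , refl) = stop (stuck-sound s any) (λ _ → refl)

  run-sound : ∀ k i s {e} → run k i s ≡ just e → Process i (realise s) (realise e)
  run-sound zero    i s eq = [ (λ ()) ∘ proj₂ , halted ] (if-just (anyApplicable? s) eq)
  run-sound (suc k) i s {e} eq = [ continue , halted ] (if-just (anyApplicable? s) eq)
    where
    continue : anyApplicable? s ≡ true × (propagate 2 (rule i) s >>= run k (next i)) ≡ just e →
               Process i (realise s) (realise e)
    continue (any , rest) =
      let s' , prop , rest' = >>=-just (propagate 2 (rule i) s) rest
      in go (unstuck-sound s any) (propagate-sound 2 (rule i) s prop) (run-sound k (next i) s' rest')

  monochrome-sound : ∀ t s → T (monochrome? t s) → ∀ v → realise s v ≡ t
  monochrome-sound t s mono (inj₁ i) =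
    only-image-paletteOf (c ∘ inj₁) (s A) t (proj₁ (to (T-∧ {only (image pa (s A)) t}) mono)) i
  monochrome-sound t s mono (inj₂ j) =
    only-image-paletteOf (c ∘ inj₂) (s B) t (proj₂ (to (T-∧ {only (image pa (s A)) t}) mono)) j

  EndsMonochrome : Color → Set
  EndsMonochrome t = ∃ λ e → EndState c e × (∀ v → e v ≡ t)

  endsIn-sound : ∀ t → T (endsIn? t) → EndsMonochrome t
  endsIn-sound t ends =
    let s , halts , mono = T-maybe (run 4 r12 λ _ → id) ends
    in realise s , run-sound 4 r12 (λ _ → id) halts , monochrome-sound t s mono

  admissible-palettes : Fin m → Fin n → (∀ x → ∃ λ v → c v ≡ x) → T (admissible pa pb)
  admissible-palettes i j covered =
    from T-∧ (nonEmpty-paletteOf (c ∘ inj₁) i ,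
      from T-∧ (nonEmpty-paletteOf (c ∘ inj₂) j ,
        from (T-everyColour λ x → pa ∋ x ∨ pb ∋ x) present))
    where
    present : ∀ x → T (pa ∋ x ∨ pb ∋ x)
    present x with covered x
    ... | inj₁ i , e = from T-∨ (inj₁ (from (T-paletteOf-∋ (c ∘ inj₁) x) (i , e)))
    ... | inj₂ j , e = from (T-∨ {pa ∋ x}) (inj₂ (from (T-paletteOf-∋ (c ∘ inj₂) x) (j , e)))

  T-someSideAll3 :
    T (only pa c3 ∨ only pb c3) ⇔ ((∀ a → c (inj₁ a) ≡ c3) ⊎ (∀ b → c (inj₂ b) ≡ c3))
  T-someSideAll3 =
    ⇔-trans T-∨ (T-only-paletteOf (c ∘ inj₁) c3 ⊎-⇔ T-only-paletteOf (c ∘ inj₂) c3)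

lemma4p7 : (m n : ℕ) → m ≥ 1 → n ≥ 1 →
    (c : Fin m ⊎ Fin n → Color) →
    (∀ x → ∃ λ v → c v ≡ x) →
    (((∀ a → c (inj₁ a) ≡ c3) ⊎ (∀ b → c (inj₂ b) ≡ c3)) →
      ∃ λ e → Forcing.EndState (KAdj m n) c e × (∀ v → e v ≡ c1))
    × (¬ ((∀ a → c (inj₁ a) ≡ c3) ⊎ (∀ b → c (inj₂ b) ≡ c3)) →
      ∃ λ e → Forcing.EndState (KAdj m n) c e × (∀ v → e v ≡ c3))
lemma4p7 (suc m) (suc n) _ _ c covered =
  (λ someSide3 → subst EndsMonochrome (if-T (from T-someSideAll3 someSide3)) endsInExpected) ,
  (λ noSide3 → subst EndsMonochrome (if-¬T (noSide3 ∘ to T-someSideAll3)) endsInExpected)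
  where
  open OnCompleteBipartite (suc m) (suc n) c
  endsInExpected : EndsMonochrome (expectedColour pa pb)
  endsInExpected =
    endsIn-sound _ (endsIn-expectedColour pa pb (admissible-palettes zero zero covered))
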